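{- For finite graphs $G$ and $H$ and every integer $\ell \ge 0$, \[Z_{(\ell)}(G \Box H) \le \min\{\,|V(G)|\,Z_{(\ell)}(H),\ |V(H)|\,Z_{(\ell)}(G)\,\}.\]
   Context: Let $G=(V,E)$ be a finite simple graph. Color-change rule (zero forcing): given a set of colored vertices, a colored vertex with exactly one uncolored neighbor colors ("forces") that neighbor. Leaks: for a set $L\subseteq V$, placing a leak on each $v\in L$ means attaching to $v$ one new pendant vertex (adjacent only to $v$) which is never initially colored; consequently no vertex of $L$ can ever force a vertex of $V$. A set $S\subseteq V$ is an $\ell$-forcing set if for every $L\subseteq V$ with $|L|\le \ell$, starting with exactly the vertices of $S$ colored and repeatedly applying the color-change rule in the graph with leaks on $L$, every vertex of $V$ eventually becomes colored. $Z_{(\ell)}(G)$ is the minimum size of an $\ell$-forcing set. The Cartesian product $G\Box H$ has vertex set $V(G)\times V(H)$, with $(x,y)\sim(x',y')$ iff ($x=x'$ and $y\sim y'$ in $H$) or ($y=y'$ and $x\sim x'$ in $G$). -}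

module Defs where

open import Data.Nat using (ℕ; _*_; _≤_)
open import Data.Fin using (Fin; remQuot)
open import Data.Fin.Subset using (Subset; _∈_; _∉_; ∣_∣)
open import Data.Product using (_×_; _,_; proj₁; proj₂; Σ; ∃)
open import Data.Sum using (_⊎_; inj₁; inj₂)
open import Relation.Nullary using (¬_)
open import Relation.Binary.PropositionalEquality using (_≡_; refl; sym)

record Graph : Set₁ where
  field
    order : ℕ
    Adj   : Fin order → Fin order → Set
    sym-Adj   : ∀ {u v} → Adj u v → Adj v u
    irrefl-Adj : ∀ {v} → ¬ Adj v v

open Graph public

-- A vertex u forces its neighbour v if u is colored, u is not leaked
-- (a leak is an uncolorable-by-V pendant neighbour, so u never forces a
-- vertex of V), and every other neighbour w ≠ v of u is colored.
-- Since the color-change rule is monotone, the final colored set is the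
-- least set closed under this rule.
data Colored (G : Graph) (S L : Subset (order G)) : Fin (order G) → Set where
  initial : ∀ {v} → v ∈ S → Colored G S L v
  force   : ∀ {u v} → Colored G S L u → u ∉ L → Adj G u v →
            (∀ w → Adj G u w → ¬ (w ≡ v) → Colored G S L w) →
            Colored G S L v

IsLForcing : (ℓ : ℕ) (G : Graph) → Subset (order G) → Set
IsLForcing ℓ G S = ∀ (L : Subset (order G)) → ∣ L ∣ ≤ ℓ → ∀ v → Colored G S L v

IsZℓ : (ℓ : ℕ) (G : Graph) → ℕ → Set
IsZℓ ℓ G k =
  (Σ (Subset (order G)) λ S → IsLForcing ℓ G S × ∣ S ∣ ≡ k) ×
  (∀ S → IsLForcing ℓ G S → k ≤ ∣ S ∣)

-- Cartesian product; vertex p of Fin (order G * order H) corresponds to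
-- the pair remQuot p : Fin (order G) × Fin (order H) (a bijection).
□-Adj : (G H : Graph) → Fin (order G * order H) → Fin (order G * order H) → Set
□-Adj G H p q =
  let (x , y)   = remQuot {order G} (order H) p
      (x' , y') = remQuot {order G} (order H) q
  in (x ≡ x' × Adj H y y') ⊎ (y ≡ y' × Adj G x x')

_□_ : Graph → Graph → Graph
G □ H = record
  { order = order G * order H
  ; Adj = □-Adj G H
  ; sym-Adj = λ { (inj₁ (e , a)) → inj₁ (sym e , sym-Adj H a)
                ; (inj₂ (e , a)) → inj₂ (sym e , sym-Adj G a) }
  ; irrefl-Adj = λ { (inj₁ (_ , a)) → irrefl-Adj H a
                   ; (inj₂ (_ , a)) → irrefl-Adj G a } }

-- If S forces H with ℓ leaks, then V(G) × S forces G □ H with ℓ leaks: a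
-- leak set L of G □ H projects to a leak set of H of size at most |L|, and
-- every force u → v of H with those leaks lifts to the force (x, u) → (x, v)
-- in each fibre, because the remaining neighbours (x′, u) of (x, u) lie over
-- the already coloured vertex u. Symmetrically S × V(H) forces G □ H for
-- every ℓ-forcing set S of G, and the two sets have sizes |V(G)| |S| and
-- |S| |V(H)|.
module Submission where

open import Data.Bool using (if_then_else_)
open import Data.Fin using (Fin; zero; suc; _↑ˡ_; _↑ʳ_; combine; remQuot; quotient; remainder)
open import Data.Fin.Properties using (remQuot-combine; combine-remQuot)
open import Data.Fin.Subset using (Subset; _∈_; ∣_∣; _∪_; ⊥; ⊤; ⁅_⁆; inside; outside)
open import Data.Fin.Subset.Properties using (∣p∣≤∣x∷p∣; ∣⊥∣≡0; ∣⊤∣≡n; ∣⁅x⁆∣≡1; x∈⁅x⁆; x∈p∪q⁺; ∈⊤)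
open import Data.Nat using (ℕ; _+_; _*_; _≤_; _⊓_; z≤n; s≤s)
open import Data.Nat.Properties using (≤-reflexive; ≤-trans; +-suc; +-monoʳ-≤; ⊓-glb; *-comm; module ≤-Reasoning)
open import Data.Product using (_×_; _,_; proj₁; proj₂; Σ-syntax; uncurry)
open import Data.Sum using (_⊎_; inj₁; inj₂; [_,_]′)
open import Data.Vec using ([]; _∷_; _++_; here; there)
open import Function using (_∘_)
open import Relation.Binary.PropositionalEquality using (_≡_; _≢_; refl; sym; trans; cong; cong₂; subst; module ≡-Reasoning)

open import Defs

private
  variable
    m n : ℕ

∣p∪q∣≤∣p∣+∣q∣ : (p q : Subset n) → ∣ p ∪ q ∣ ≤ ∣ p ∣ + ∣ q ∣
∣p∪q∣≤∣p∣+∣q∣ []            []            = z≤n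
∣p∪q∣≤∣p∣+∣q∣ (inside  ∷ p) (x ∷ q)       =
  s≤s (≤-trans (∣p∪q∣≤∣p∣+∣q∣ p q) (+-monoʳ-≤ ∣ p ∣ (∣p∣≤∣x∷p∣ x q)))
∣p∪q∣≤∣p∣+∣q∣ (outside ∷ p) (inside  ∷ q) =
  subst (ℕ.suc ∣ p ∪ q ∣ ≤_) (sym (+-suc ∣ p ∣ ∣ q ∣)) (s≤s (∣p∪q∣≤∣p∣+∣q∣ p q))
∣p∪q∣≤∣p∣+∣q∣ (outside ∷ p) (outside ∷ q) = ∣p∪q∣≤∣p∣+∣q∣ p q

∣p++q∣≡∣p∣+∣q∣ : (p : Subset m) (q : Subset n) → ∣ p ++ q ∣ ≡ ∣ p ∣ + ∣ q ∣
∣p++q∣≡∣p∣+∣q∣ []            q = refl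
∣p++q∣≡∣p∣+∣q∣ (inside  ∷ p) q = cong ℕ.suc (∣p++q∣≡∣p∣+∣q∣ p q)
∣p++q∣≡∣p∣+∣q∣ (outside ∷ p) q = ∣p++q∣≡∣p∣+∣q∣ p q

x∈p⇒x↑ˡ∈p++q : ∀ {x} {p : Subset m} {q : Subset n} → x ∈ p → x ↑ˡ n ∈ p ++ q
x∈p⇒x↑ˡ∈p++q here        = here
x∈p⇒x↑ˡ∈p++q (there x∈p) = there (x∈p⇒x↑ˡ∈p++q x∈p)

x∈q⇒m↑ʳx∈p++q : ∀ {x} (p : Subset m) {q : Subset n} → x ∈ q → m ↑ʳ x ∈ p ++ q
x∈q⇒m↑ʳx∈p++q []      x∈q = x∈q
x∈q⇒m↑ʳx∈p++q (_ ∷ p) x∈q = there (x∈q⇒m↑ʳx∈p++q p x∈q)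

image-cover : (f : Fin m → Fin n) (L : Subset m) →
              Σ[ L′ ∈ Subset n ] ∣ L′ ∣ ≤ ∣ L ∣ × (∀ {x} → x ∈ L → f x ∈ L′)
image-cover {n = n} f [] = ⊥ , ≤-reflexive (∣⊥∣≡0 n) , λ ()
image-cover f (outside ∷ L) with image-cover (f ∘ suc) L
... | L′ , |L′|≤|L| , cover = L′ , |L′|≤|L| , λ { (there x∈L) → cover x∈L }
image-cover f (inside ∷ L) with image-cover (f ∘ suc) L
... | L′ , |L′|≤|L| , cover = ⁅ f zero ⁆ ∪ L′ , size , member
  where
    open ≤-Reasoning
    size : ∣ ⁅ f zero ⁆ ∪ L′ ∣ ≤ ℕ.suc ∣ L ∣
    size = begin
      ∣ ⁅ f zero ⁆ ∪ L′ ∣     ≤⟨ ∣p∪q∣≤∣p∣+∣q∣ ⁅ f zero ⁆ L′ ⟩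
      ∣ ⁅ f zero ⁆ ∣ + ∣ L′ ∣ ≡⟨ cong (_+ ∣ L′ ∣) (∣⁅x⁆∣≡1 (f zero)) ⟩
      ℕ.suc ∣ L′ ∣            ≤⟨ s≤s |L′|≤|L| ⟩
      ℕ.suc ∣ L ∣             ∎
    member : ∀ {x} → x ∈ inside ∷ L → f x ∈ ⁅ f zero ⁆ ∪ L′
    member here        = x∈p∪q⁺ (inj₁ (x∈⁅x⁆ (f zero)))
    member (there x∈L) = x∈p∪q⁺ (inj₂ (cover x∈L))

-- p ⊠ q ⊆ Fin (m * n) is the product set p × q, laid out as combine lays out pairs.
infixr 7 _⊠_
_⊠_ : Subset m → Subset n → Subset (m * n)
[]      ⊠ q = []
(b ∷ p) ⊠ q = (if b then q else ⊥) ++ p ⊠ q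

∣p⊠q∣≡∣p∣*∣q∣ : (p : Subset m) (q : Subset n) → ∣ p ⊠ q ∣ ≡ ∣ p ∣ * ∣ q ∣
∣p⊠q∣≡∣p∣*∣q∣ []            q = refl
∣p⊠q∣≡∣p∣*∣q∣ (inside  ∷ p) q =
  trans (∣p++q∣≡∣p∣+∣q∣ q (p ⊠ q)) (cong (∣ q ∣ +_) (∣p⊠q∣≡∣p∣*∣q∣ p q))
∣p⊠q∣≡∣p∣*∣q∣ {n = n} (outside ∷ p) q =
  trans (∣p++q∣≡∣p∣+∣q∣ (⊥ {n}) (p ⊠ q)) (cong₂ _+_ (∣⊥∣≡0 n) (∣p⊠q∣≡∣p∣*∣q∣ p q))

combine∈p⊠q : ∀ {x y} {p : Subset m} {q : Subset n} → x ∈ p → y ∈ q → combine x y ∈ p ⊠ q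
combine∈p⊠q here y∈q = x∈p⇒x↑ˡ∈p++q y∈q
combine∈p⊠q {p = b ∷ p} {q} (there x∈p) y∈q =
  x∈q⇒m↑ʳx∈p++q (if b then q else ⊥) (combine∈p⊠q {p = p} x∈p y∈q)

∈-⊠ : ∀ {v : Fin (m * n)} {p q} → quotient {m} n v ∈ p → remainder {m} n v ∈ q → v ∈ p ⊠ q
∈-⊠ {m} {n} {v} {p} {q} x∈p y∈q = subst (_∈ p ⊠ q) (combine-remQuot {m} n v) (combine∈p⊠q x∈p y∈q)

remQuot-injective : ∀ {v w : Fin (m * n)} → remQuot {m} n v ≡ remQuot n w → v ≡ w
remQuot-injective {m} {n} {v} {w} eq = begin
  v                                   ≡⟨ combine-remQuot {m} n v ⟨
  uncurry combine (remQuot {m} n v)   ≡⟨ cong (uncurry combine) eq ⟩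
  uncurry combine (remQuot {m} n w)   ≡⟨ combine-remQuot {m} n w ⟩
  w                                   ∎
  where open ≡-Reasoning

-- Just what is needed to replay a K-force u → π v as the P-force u′ → v: every
-- other neighbour of u′ lies over a vertex coloured before that K-force.
LiftsForces : (P K : Graph) → (Fin (order P) → Fin (order K)) → Set
LiftsForces P K π =
  ∀ v u → Adj K u (π v) →
  Σ[ u′ ∈ Fin (order P) ] π u′ ≡ u × Adj P u′ v ×
    (∀ w → Adj P u′ w → w ≢ v → π w ≡ u ⊎ Adj K u (π w) × π w ≢ π v)

module _ {P K : Graph} {π : Fin (order P) → Fin (order K)} (lifts : LiftsForces P K π) where

  colored-lift : ∀ {S L SK LK} → (∀ {v} → π v ∈ SK → v ∈ S) → (∀ {v} → v ∈ L → π v ∈ LK) →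
                 ∀ {y} → Colored K SK LK y → ∀ v → π v ≡ y → Colored P S L v
  colored-lift S⊇ L⊆ (initial y∈SK) v refl = initial (S⊇ y∈SK)
  colored-lift S⊇ L⊆ (force {u} cu u∉LK u~πv rest) v refl with lifts v u u~πv
  ... | u′ , refl , u′~v , others =
    force (colored-lift S⊇ L⊆ cu u′ refl) (u∉LK ∘ L⊆) u′~v
      λ w u′~w w≢v → [ colored-lift S⊇ L⊆ cu w
                     , (λ (u~πw , πw≢πv) → colored-lift S⊇ L⊆ (rest (π w) u~πw πw≢πv) w refl)
                     ]′ (others w u′~w w≢v)

  forcing-lift : ∀ {ℓ SK S} → IsLForcing ℓ K SK → (∀ {v} → π v ∈ SK → v ∈ S) → IsLForcing ℓ P S
  forcing-lift SK-forces S⊇ L |L|≤ℓ v with image-cover π L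
  ... | LK , |LK|≤|L| , L⊆ = colored-lift S⊇ L⊆ (SK-forces LK (≤-trans |LK|≤|L| |L|≤ℓ) (π v)) v refl

module _ (G H : Graph) where

  private
    -- □-Adj G H v w is definitionally Adj× (remQuot v) (remQuot w).
    Adj× : Fin (order G) × Fin (order H) → Fin (order G) × Fin (order H) → Set
    Adj× (x , y) (x′ , y′) = (x ≡ x′ × Adj H y y′) ⊎ (y ≡ y′ × Adj G x x′)

  remainder-lifts : LiftsForces (G □ H) H (remainder {order G} (order H))
  remainder-lifts v u u~y = combine x u , cong proj₂ coords , u′~v , others
    where
      x : Fin (order G)
      x = quotient (order H) v
      coords : remQuot (order H) (combine x u) ≡ (x , u)
      coords = remQuot-combine x u
      u′~v : □-Adj G H (combine x u) v
      u′~v = subst (λ c → Adj× c (remQuot (order H) v)) (sym coords) (inj₁ (refl , u~y))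
      others : ∀ w → □-Adj G H (combine x u) w → w ≢ v →
               remainder {order G} (order H) w ≡ u ⊎
               Adj H u (remainder {order G} (order H) w) ×
               remainder {order G} (order H) w ≢ remainder {order G} (order H) v
      others w u′~w w≢v with subst (λ c → Adj× c (remQuot (order H) w)) coords u′~w
      ... | inj₁ (x≡ , u~y′) = inj₂ (u~y′ , λ y′≡y → w≢v (remQuot-injective (cong₂ _,_ (sym x≡) y′≡y)))
      ... | inj₂ (u≡ , _)    = inj₁ (sym u≡)

  quotient-lifts : LiftsForces (G □ H) G (quotient {order G} (order H))
  quotient-lifts v u u~x = combine u y , cong proj₁ coords , u′~v , others
    where
      y : Fin (order H)
      y = remainder {order G} (order H) v
      coords : remQuot (order H) (combine u y) ≡ (u , y)
      coords = remQuot-combine u y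
      u′~v : □-Adj G H (combine u y) v
      u′~v = subst (λ c → Adj× c (remQuot (order H) v)) (sym coords) (inj₂ (refl , u~x))
      others : ∀ w → □-Adj G H (combine u y) w → w ≢ v →
               quotient (order H) w ≡ u ⊎
               Adj G u (quotient (order H) w) × quotient (order H) w ≢ quotient (order H) v
      others w u′~w w≢v with subst (λ c → Adj× c (remQuot (order H) w)) coords u′~w
      ... | inj₁ (u≡ , _)    = inj₁ (sym u≡)
      ... | inj₂ (y≡ , u~x′) = inj₂ (u~x′ , λ x′≡x → w≢v (remQuot-injective (cong₂ _,_ x′≡x (sym y≡))))

  ⊤⊠-forcing : ∀ {ℓ S} → IsLForcing ℓ H S → IsLForcing ℓ (G □ H) (⊤ {order G} ⊠ S)
  ⊤⊠-forcing S-forces = forcing-lift remainder-lifts S-forces (∈-⊠ {order G} ∈⊤)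

  ⊠⊤-forcing : ∀ {ℓ S} → IsLForcing ℓ G S → IsLForcing ℓ (G □ H) (S ⊠ ⊤ {order H})
  ⊠⊤-forcing S-forces = forcing-lift quotient-lifts S-forces (λ x∈S → ∈-⊠ {order G} x∈S ∈⊤)

proposition17 : (G H : Graph) (ℓ kG kH kGH : ℕ) →
    IsZℓ ℓ G kG → IsZℓ ℓ H kH → IsZℓ ℓ (G □ H) kGH →
    kGH ≤ (order G * kH) ⊓ (order H * kG)
proposition17 G H ℓ kG kH kGH ((SG , SG-forces , |SG|≡kG) , _) ((SH , SH-forces , |SH|≡kH) , _) (_ , minimal) =
  ⊓-glb
    (begin
      kGH             ≤⟨ minimal (⊤ {order G} ⊠ SH) (⊤⊠-forcing G H SH-forces) ⟩
      ∣ ⊤ {order G} ⊠ SH ∣      ≡⟨ ∣p⊠q∣≡∣p∣*∣q∣ (⊤ {order G}) SH ⟩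
      ∣ ⊤ {order G} ∣ * ∣ SH ∣  ≡⟨ cong₂ _*_ (∣⊤∣≡n (order G)) |SH|≡kH ⟩
      order G * kH    ∎)
    (begin
      kGH             ≤⟨ minimal (SG ⊠ ⊤ {order H}) (⊠⊤-forcing G H SG-forces) ⟩
      ∣ SG ⊠ ⊤ {order H} ∣      ≡⟨ ∣p⊠q∣≡∣p∣*∣q∣ SG (⊤ {order H}) ⟩
      ∣ SG ∣ * ∣ ⊤ {order H} ∣  ≡⟨ cong₂ _*_ |SG|≡kG (∣⊤∣≡n (order H)) ⟩
      kG * order H    ≡⟨ *-comm kG (order H) ⟩
      order H * kG    ∎)
  where open ≤-Reasoning
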